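{- Let $\mathcal{B}$ be a building set on a finite set $X$, let $\mathcal{C}$ be its generating collection and $\mathcal{C}_{\min}$ the collection of inclusion-minimal elements of $\mathcal{C}$. Then $\Psi(\mathcal{B})=\Psi(\mathcal{C}_{\min})$, where the right side is the chromatic symmetric function of the hypergraph $\mathcal{C}_{\min}$ on $X$.
   Context: A building set on a finite set $X$ is a collection $\mathcal{B}$ of nonempty subsets of $X$ such that (B1) if $S,S'\in\mathcal{B}$ and $S\cap S'\neq\emptyset$ then $S\cup S'\in\mathcal{B}$, and (B2) $\{i\}\in\mathcal{B}$ for all $i\in X$. The restriction is $\mathcal{B}|_I=\{S\in\mathcal{B}:S\subset I\}$; $\mathcal{B}$ is discrete if it has only singletons. For a collection $\mathcal{C}$ of subsets of $X$ each with at least two elements, $\mathcal{B}(\mathcal{C})$ denotes the smallest building set on $X$ containing $\mathcal{C}$ (all unions of sets of $\mathcal{C}$ obtained by repeatedly uniting intersecting sets, plus all singletons). The generating collection of $\mathcal{B}$ is the unique minimal collection $\mathcal{C}$ with $\mathcal{B}=\mathcal{B}(\mathcal{C})$. For a composition $\alpha=(a_1,\dots,a_k)$ of $n=|X|$, $\zeta_\alpha(\mathcal{B})$ is the number of ordered decompositions $X=J_1\sqcup\dots\sqcup J_k$ with $|J_i|=a_i$ and each $\mathcal{B}|_{J_i}$ discrete, and $\Psi(\mathcal{B})=\sum_{\alpha\models n}\zeta_\alpha(\mathcal{B})M_\alpha$, where $M_\alpha=\sum_{i_1<\dots<i_k}x_{i_1}^{a_1}\cdots x_{i_k}^{a_k}$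 are monomial quasi-symmetric functions. A hypergraph on $X$ is any collection $\mathcal{H}$ of subsets of $X$; a proper coloring of $\mathcal{H}$ is a map $f:X\to\mathbb{N}$ that is not constant on any $S\in\mathcal{H}$ with $|S|\geq2$, and $\Psi(\mathcal{H})=\sum_{f\text{ proper}}\prod_{i\in X}x_{f(i)}$. -}

module Defs where

open import Data.Nat using (ℕ; zero; suc; _+_; _*_; _≤_; _≡ᵇ_; _≤ᵇ_)
open import Data.Bool using (Bool; true; false; _∧_; _∨_; not; if_then_else_)
open import Data.Fin using (Fin)
import Data.Fin.Properties as FinP
open import Data.Fin.Subset using (Subset; inside; outside; _∈_; _⊆_; _∩_; _∪_; ⁅_⁆; ∣_∣; Nonempty)
open import Data.Fin.Subset.Properties using (_⊆?_; _∈?_)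
open import Data.List using (List; []; _∷_; concatMap; map; filter; length; upTo; allFin)
open import Data.Bool.ListAction using (all; any)
open import Data.Nat.ListAction using (sum)
import Data.List.Relation.Binary.Pointwise as LP
open import Data.Vec using (Vec; []; _∷_; lookup; toList; zip)
import Data.Vec.Properties as VecP
open import Data.Bool.Properties using () renaming (_≟_ to _≟ᵇ_)
open import Data.Product using (_×_; _,_)
open import Relation.Nullary.Decidable using (⌊_⌋)
open import Relation.Binary.PropositionalEquality using (_≡_)
open import Function.Bundles using (_⇔_)

-- The ground set is X = Fin n.  A collection of subsets of X (building
-- set, hypergraph, ...) is a decidable family, i.e. a Bool-valued
-- predicate on Subset n.

Coll : ℕ → Set
Coll n = Subset n → Bool

infix 4 _∈ᶜ_
_∈ᶜ_ : ∀ {n} → Subset n → Coll n → Set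
S ∈ᶜ C = C S ≡ true

_⊆ᶜ_ : ∀ {n} → Coll n → Coll n → Set
C ⊆ᶜ D = ∀ S → S ∈ᶜ C → S ∈ᶜ D

record IsBuildingSet {n : ℕ} (B : Coll n) : Set where
  field
    nonempty : ∀ S → S ∈ᶜ B → Nonempty S
    B1 : ∀ S S′ → S ∈ᶜ B → S′ ∈ᶜ B → Nonempty (S ∩ S′) → (S ∪ S′) ∈ᶜ B
    B2 : ∀ (i : Fin n) → ⁅ i ⁆ ∈ᶜ B

InGenerated : ∀ {n} → Coll n → Subset n → Set
InGenerated {n} C S = ∀ (B′ : Coll n) → IsBuildingSet B′ → C ⊆ᶜ B′ → S ∈ᶜ B′

Generates : ∀ {n} → Coll n → Coll n → Set
Generates C B = ∀ S → (S ∈ᶜ B) ⇔ InGenerated C S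

record IsGeneratingCollection {n : ℕ} (B C : Coll n) : Set where
  field
    atLeastTwo : ∀ S → S ∈ᶜ C → 2 ≤ ∣ S ∣
    generates  : Generates C B
    minimal    : ∀ (C′ : Coll n) → C′ ⊆ᶜ C → Generates C′ B → C ⊆ᶜ C′

allVec : ∀ {A : Set} → List A → (k : ℕ) → List (Vec A k)
allVec xs zero    = [] ∷ []
allVec xs (suc k) = concatMap (λ x → map (x ∷_) (allVec xs k)) xs

allSubsets : (n : ℕ) → List (Subset n)
allSubsets n = allVec (inside ∷ outside ∷ []) n

countL : ∀ {A : Set} → (A → Bool) → List A → ℕ
countL p xs = length (filter (λ x → p x Data.Bool.≟ true) xs)
  where import Data.Bool

_==ˢ_ : ∀ {n} → Subset n → Subset n → Bool
S ==ˢ T = ⌊ VecP.≡-dec _≟ᵇ_ S T ⌋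

_⊆ᵇ_ : ∀ {n} → Subset n → Subset n → Bool
S ⊆ᵇ T = ⌊ S ⊆? T ⌋

_∈ᵇ_ : ∀ {n} → Fin n → Subset n → Bool
i ∈ᵇ S = ⌊ i ∈? S ⌋

minimalElems : ∀ {n} → Coll n → Coll n
minimalElems {n} C S =
  C S ∧ not (any (λ T → C T ∧ (T ⊆ᵇ S) ∧ not (T ==ˢ S)) (allSubsets n))

discreteOn : ∀ {n} → Coll n → Subset n → Bool
discreteOn {n} B J =
  all (λ S → not (B S ∧ (S ⊆ᵇ J) ∧ (2 ≤ᵇ ∣ S ∣))) (allSubsets n)

-- (J_1,…,J_k) is an ordered decomposition X = J_1 ⊔ … ⊔ J_k with
-- |J_i| = a_i and each B|_{J_i} discrete
goodDecomp : ∀ {n} → Coll n → (α : List ℕ) → Vec (Subset n) (length α) → Bool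
goodDecomp {n} B α Js =
  all (λ i → countL (λ J → i ∈ᵇ J) (toList Js) ≡ᵇ 1) (allFin n)
  ∧ all (λ p → ∣ Data.Product.proj₁ p ∣ ≡ᵇ Data.Product.proj₂ p)
        (toList (zip Js (Data.Vec.fromList α)))
  ∧ all (discreteOn B) (toList Js)
  where import Data.Product
        import Data.Vec

ζ : ∀ {n} → List ℕ → Coll n → ℕ
ζ {n} α B = countL (goodDecomp B α) (allVec (allSubsets n) (length α))

compositions : ℕ → List (List ℕ)
compositions n =
  filter (λ α → sum α Data.Nat.≟ n)
    (concatMap (λ k → map toList (allVec (map suc (upTo n)) k)) (upTo (suc n)))
  where import Data.Nat

-- Formal power series in x_0, x_1, … are compared coefficientwise; a
-- monomial x_0^{β_0} ⋯ x_{m-1}^{β_{m-1}} is given by the list β.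
-- Coefficient of x^β in M_α: 1 iff the nonzero entries of β, in order,
-- are exactly α.
listEq : List ℕ → List ℕ → Bool
listEq [] [] = true
listEq (x ∷ xs) (y ∷ ys) = (x ≡ᵇ y) ∧ listEq xs ys
listEq _ _ = false

nonzeros : List ℕ → List ℕ
nonzeros [] = []
nonzeros (zero ∷ xs) = nonzeros xs
nonzeros (suc x ∷ xs) = suc x ∷ nonzeros xs

coeffM : List ℕ → List ℕ → ℕ
coeffM α β = if listEq (nonzeros β) α then 1 else 0

-- coefficient of x^β in Ψ(B) = Σ_{α ⊨ n} ζ_α(B) M_α
coeffΨBuilding : ∀ {n} → Coll n → List ℕ → ℕ
coeffΨBuilding {n} B β = sum (map (λ α → ζ α B * coeffM α β) (compositions n))

proper : ∀ {n m} → Coll n → Vec (Fin m) n → Bool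
proper {n} H f =
  all (λ S → not (H S ∧ (2 ≤ᵇ ∣ S ∣))
             ∨ any (λ i → any (λ j → (i ∈ᵇ S) ∧ (j ∈ᵇ S)
                                  ∧ not ⌊ lookup f i FinP.≟ lookup f j ⌋)
                              (allFin n)) (allFin n))
      (allSubsets n)

-- ∏_i x_{f(i)} = x^β, i.e. colour c is used exactly β_c times
hasExponents : ∀ {n} → (β : List ℕ) → Vec (Fin (length β)) n → Bool
hasExponents {n} β f =
  all (λ c → countL (λ i → ⌊ lookup f i FinP.≟ c ⌋) (allFin n)
             ≡ᵇ Data.List.lookup β c)
      (allFin (length β))
  where import Data.List

-- coefficient of x^β in Ψ(H) = number of proper colorings f with
-- ∏_i x_{f(i)} = x^β.  (Such f only use colours < length β.)
coeffΨHyper : ∀ {n} → Coll n → List ℕ → ℕ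
coeffΨHyper {n} H β =
  countL (λ f → proper H f ∧ hasExponents β f)
         (allVec (allFin (length β)) n)

module Submission where

-- The coefficient of x^β in Ψ(B) is ζ_{nonzeros β}(B): only the composition obtained by deleting the
-- zero entries of β can contribute, and if those entries do not sum to n then this ζ vanishes as well,
-- because the block sizes of a decomposition add up to n.  Filling the zero entries back in with empty
-- blocks, ζ_{nonzeros β}(B) counts ordered decompositions of X into B-discrete blocks of sizes β, and
-- taking colour classes is a bijection from colourings with exponent β onto such decompositions.
-- Finally B|_J is discrete iff J contains no member of C_min: every S ∈ B with |S| ≥ 2 contains a
-- member of C (compare B = B(C) with the building set of singletons and supersets of members of C),
-- hence an inclusion-minimal one.

open import Defs
open import Data.Bool using (Bool; true; false; _∧_; _∨_; not; if_then_else_)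
open import Data.Bool.Properties using (T-≡) renaming (_≟_ to _≟ᵇ_)
open import Data.Fin using (Fin; zero; suc)
open import Data.Fin.Subset using (Subset; _∈_; _⊆_; _⊂_; _∩_; _∪_; ⁅_⁆; ∣_∣; Nonempty) renaming (⊥ to ∅)
import Data.Fin.Subset.Properties as Subset
open import Data.Fin.Subset.Induction using (⊂-wellFounded)
import Data.Fin.Properties as Finₚ
open import Data.List using (List; []; _∷_; map; filter; length; concatMap; cartesianProductWith; allFin; _++_)
open import Data.List.Membership.Propositional using (lose) renaming (_∈_ to _∈ₗ_)
import Data.List.Membership.Propositional.Properties as ∈ₗ
import Data.List as List
import Data.List.Properties as Listₚ
open import Data.List.Relation.Unary.All as All using (All; []; _∷_)
open import Data.List.Relation.Unary.Any as Any using (Any; here; there)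
open import Data.List.Relation.Unary.Unique.Propositional using (Unique; []; _∷_)
import Data.List.Relation.Unary.AllPairs as AllPairs
import Data.List.Relation.Unary.AllPairs.Properties as AllPairs
open import Data.List.Relation.Binary.Disjoint.Propositional using (Disjoint)
import Data.List.Relation.Unary.Unique.Propositional.Properties as Unique
open import Data.Bool.ListAction using (all; any)
open import Data.Nat.ListAction using (sum)
open import Data.Nat using (ℕ; zero; suc; _+_; _*_; _≤_; _<_; _≡ᵇ_; _≤ᵇ_; z≤n; s≤s)
import Data.Nat.Properties as ℕ
open import Algebra.Properties.CommutativeSemigroup ℕ.+-commutativeSemigroup using (interchange)
open import Data.Product using (∃; ∃₂; ∃!; _×_; _,_; proj₁; proj₂)
open import Data.Sum as Sum using (_⊎_; inj₁; inj₂; [_,_]′)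
open import Data.Vec using (Vec; []; _∷_)
import Data.Vec as Vec
import Data.Vec.Properties as Vecₚ
import Data.Vec.Relation.Unary.All as VecAll
import Data.Vec.Relation.Unary.All.Properties as VecAllₚ
open import Function using (_∘_)
open import Function.Bundles using (_⇔_; mk⇔; Equivalence)
open import Induction.WellFounded using (Acc; acc)
open import Relation.Nullary using (¬_; Dec; yes; no; contradiction; _×-dec_)
open import Relation.Nullary.Decidable using (⌊_⌋; ⌊⌋-map′)
open import Relation.Unary using (Decidable)
open import Relation.Binary.PropositionalEquality using (_≡_; _≢_; refl; sym; trans; cong; cong₂; subst; module ≡-Reasoning)

open Equivalence using (to; from)

⌊⌋≡true⇔ : ∀ {P : Set} (d : Dec P) → ⌊ d ⌋ ≡ true ⇔ P
⌊⌋≡true⇔ (yes p) = mk⇔ (λ _ → p) (λ _ → refl)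
⌊⌋≡true⇔ (no ¬p) = mk⇔ (λ ()) (λ p → contradiction p ¬p)

∧≡true⇔ : ∀ {a b} → a ∧ b ≡ true ⇔ (a ≡ true × b ≡ true)
∧≡true⇔ {true}  = mk⇔ (refl ,_) proj₂
∧≡true⇔ {false} = mk⇔ (λ ()) (λ ())

∨≡true⇔ : ∀ {a b} → a ∨ b ≡ true ⇔ (a ≡ true ⊎ b ≡ true)
∨≡true⇔ {true}  = mk⇔ inj₁ (λ _ → refl)
∨≡true⇔ {false} = mk⇔ inj₂ λ { (inj₁ ()) ; (inj₂ b) → b }

not≡true⇔ : ∀ {a} → not a ≡ true ⇔ (¬ a ≡ true)
not≡true⇔ {true}  = mk⇔ (λ ()) (λ ¬a → contradiction refl ¬a)
not≡true⇔ {false} = mk⇔ (λ _ ()) (λ _ → refl)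

≡ᵇ≡true⇔ : ∀ {m n} → (m ≡ᵇ n) ≡ true ⇔ m ≡ n
≡ᵇ≡true⇔ {m} {n} = mk⇔ (ℕ.≡ᵇ⇒≡ m n ∘ from T-≡) (to T-≡ ∘ ℕ.≡⇒≡ᵇ m n)

≤ᵇ≡true⇔ : ∀ {m n} → (m ≤ᵇ n) ≡ true ⇔ m ≤ n
≤ᵇ≡true⇔ {m} {n} = mk⇔ (ℕ.≤ᵇ⇒≤ m n ∘ from T-≡) (to T-≡ ∘ ℕ.≤⇒≤ᵇ)

module _ {A : Set} {p : A → Bool} where

  all≡true⇔ : ∀ {xs} → all p xs ≡ true ⇔ All (λ x → p x ≡ true) xs
  all≡true⇔ {[]}     = mk⇔ (λ _ → []) (λ _ → refl)
  all≡true⇔ {x ∷ xs} = mk⇔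
    (λ e → let px , pxs = to ∧≡true⇔ e in px ∷ to (all≡true⇔ {xs}) pxs)
    (λ { (px ∷ pxs) → from ∧≡true⇔ (px , from (all≡true⇔ {xs}) pxs) })

  any≡true⇔ : ∀ {xs} → any p xs ≡ true ⇔ Any (λ x → p x ≡ true) xs
  any≡true⇔ {[]}     = mk⇔ (λ ()) (λ ())
  any≡true⇔ {x ∷ xs} = mk⇔
    ([ here , there ∘ to (any≡true⇔ {xs}) ]′ ∘ to (∨≡true⇔ {p x}))
    (λ { (here px) → from (∨≡true⇔ {p x}) (inj₁ px)
       ; (there pxs) → from (∨≡true⇔ {p x}) (inj₂ (from (any≡true⇔ {xs}) pxs)) })

  module _ {xs : List A} (complete : ∀ x → x ∈ₗ xs) where

    all-complete⇔ : all p xs ≡ true ⇔ (∀ x → p x ≡ true)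
    all-complete⇔ = mk⇔ (λ e x → All.lookup (to (all≡true⇔ {xs}) e) (complete x))
                        (λ h → from (all≡true⇔ {xs}) (All.tabulate λ {x} _ → h x))

    any-complete⇔ : any p xs ≡ true ⇔ ∃ λ x → p x ≡ true
    any-complete⇔ = mk⇔ (Any.satisfied ∘ to (any≡true⇔ {xs}))
                        (λ (x , px) → from (any≡true⇔ {xs}) (lose (complete x) px))

concatMap-map≡cartesianProductWith : ∀ {A B C : Set} (f : A → B → C) xs ys →
  concatMap (λ x → map (f x) ys) xs ≡ cartesianProductWith f xs ys
concatMap-map≡cartesianProductWith f []       ys = refl
concatMap-map≡cartesianProductWith f (x ∷ xs) ys =
  cong (map (f x) ys ++_) (concatMap-map≡cartesianProductWith f xs ys)

module _ {A : Set} {xs : List A} where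

  ∈-allVec : ∀ {k} {v : Vec A k} → VecAll.All (_∈ₗ xs) v → v ∈ₗ allVec xs k
  ∈-allVec               VecAll.[]         = here refl
  ∈-allVec {suc k} {x ∷ v} (x∈xs VecAll.∷ v∈) =
    subst (x ∷ v ∈ₗ_) (sym (concatMap-map≡cartesianProductWith _∷_ xs (allVec xs k)))
      (∈ₗ.∈-cartesianProductWith⁺ _∷_ x∈xs (∈-allVec v∈))

  ∈-allVec-complete : (∀ x → x ∈ₗ xs) → ∀ {k} (v : Vec A k) → v ∈ₗ allVec xs k
  ∈-allVec-complete complete v = ∈-allVec (VecAll.universal complete v)

  allVec-unique : Unique xs → ∀ k → Unique (allVec xs k)
  allVec-unique u zero    = [] ∷ []
  allVec-unique u (suc k) =
    subst Unique (sym (concatMap-map≡cartesianProductWith _∷_ xs (allVec xs k)))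
      (Unique.cartesianProductWith⁺ _∷_ Vecₚ.∷-injective u (allVec-unique u k))

∈-allSubsets : ∀ {n} (S : Subset n) → S ∈ₗ allSubsets n
∈-allSubsets = ∈-allVec-complete λ { true → here refl ; false → there (here refl) }

allSubsets-unique : ∀ n → Unique (allSubsets n)
allSubsets-unique = allVec-unique (((λ ()) ∷ []) ∷ [] ∷ [])

∈-allColourings : ∀ {m n} (f : Vec (Fin m) n) → f ∈ₗ allVec (allFin m) n
∈-allColourings = ∈-allVec-complete ∈ₗ.∈-allFin

module _ {A : Set} where

  ∈-─ : ∀ {y z : A} {ys} (y∈ys : y ∈ₗ ys) → z ∈ₗ ys → z ≢ y → z ∈ₗ (ys Any.─ y∈ys)
  ∈-─ (here refl) (here refl) z≢y = contradiction refl z≢y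
  ∈-─ (here refl) (there z∈)  _   = z∈
  ∈-─ (there y∈)  (here refl) _   = here refl
  ∈-─ (there y∈)  (there z∈)  z≢y = there (∈-─ y∈ z∈ z≢y)

  length-≤-⊆ : ∀ {xs ys : List A} → Unique xs → (∀ {z} → z ∈ₗ xs → z ∈ₗ ys) → length xs ≤ length ys
  length-≤-⊆ {[]}     _              _   = z≤n
  length-≤-⊆ {x ∷ xs} {ys} (x∉xs ∷ u) sub = begin
    suc (length xs)                  ≤⟨ s≤s (length-≤-⊆ u sub′) ⟩
    suc (length (ys Any.─ x∈ys))     ≡⟨ sym (Listₚ.length-removeAt′ ys (Any.index x∈ys)) ⟩
    length ys                        ∎
    where
    open ℕ.≤-Reasoning
    x∈ys = sub (here refl)
    sub′ : ∀ {z} → z ∈ₗ xs → z ∈ₗ (ys Any.─ x∈ys)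
    sub′ z∈xs = ∈-─ x∈ys (sub (there z∈xs)) λ { refl → All.lookup x∉xs z∈xs refl }

  length-≡-⇔ : ∀ {xs ys : List A} → Unique xs → Unique ys →
    (∀ {z} → z ∈ₗ xs ⇔ z ∈ₗ ys) → length xs ≡ length ys
  length-≡-⇔ uxs uys xs≈ys = ℕ.≤-antisym (length-≤-⊆ uxs (to xs≈ys)) (length-≤-⊆ uys (from xs≈ys))

holds? : ∀ {A : Set} (p : A → Bool) → Decidable (λ x → p x ≡ true)
holds? p x = p x ≟ᵇ true

module _ {A : Set} {p : A → Bool} where

  countL≡1⇔∃! : ∀ {xs : List A} → Unique xs → (∀ x → x ∈ₗ xs) →
    countL p xs ≡ 1 ⇔ ∃! _≡_ (λ x → p x ≡ true)
  countL≡1⇔∃! {xs} uxs complete = mk⇔ unique-witness count-singleton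
    where
    unique-witness : countL p xs ≡ 1 → ∃! _≡_ (λ x → p x ≡ true)
    unique-witness count≡1 with filter (holds? p) xs in filtered | count≡1
    ... | x ∷ [] | _ =
      x , proj₂ (∈ₗ.∈-filter⁻ (holds? p) {xs = xs} (subst (x ∈ₗ_) (sym filtered) (here refl)))
        , λ {y} py → sym (∈-singleton (subst (y ∈ₗ_) filtered (∈ₗ.∈-filter⁺ (holds? p) (complete y) py)))
      where
      ∈-singleton : ∀ {y} → y ∈ₗ x ∷ [] → y ≡ x
      ∈-singleton (here y≡x) = y≡x
    count-singleton : ∃! _≡_ (λ x → p x ≡ true) → countL p xs ≡ 1
    count-singleton (x , px , unique) =
      length-≡-⇔ (Unique.filter⁺ (holds? p) {xs} uxs) ([] ∷ []) (mk⇔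
        (λ y∈ → here (sym (unique (proj₂ (∈ₗ.∈-filter⁻ (holds? p) {xs = xs} y∈)))))
        (λ { (here refl) → ∈ₗ.∈-filter⁺ (holds? p) (complete x) px }))

module _ {A B : Set} {p : A → Bool} {q : B → Bool} {xs : List A} {ys : List B} where

  countL-bijection : Unique xs → Unique ys → (∀ a → a ∈ₗ xs) → (∀ b → b ∈ₗ ys) →
    (g : A → B) → (∀ {a a′} → g a ≡ g a′ → a ≡ a′) →
    (∀ {b} → q b ≡ true ⇔ ∃ λ a → p a ≡ true × g a ≡ b) →
    countL p xs ≡ countL q ys
  countL-bijection uxs uys complete-xs complete-ys g g-injective image = begin
    length (filter (holds? p) xs)         ≡⟨ Listₚ.length-map g (filter (holds? p) xs) ⟨
    length (map g (filter (holds? p) xs)) ≡⟨ length-≡-⇔ unique-image (Unique.filter⁺ (holds? q) {ys} uys)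
                                                            (mk⇔ image⊆ ⊆image) ⟩
    length (filter (holds? q) ys)         ∎
    where
    open ≡-Reasoning
    unique-image : Unique (map g (filter (holds? p) xs))
    unique-image = Unique.map⁺ g-injective (Unique.filter⁺ (holds? p) {xs} uxs)
    image⊆ : ∀ {b} → b ∈ₗ map g (filter (holds? p) xs) → b ∈ₗ filter (holds? q) ys
    image⊆ {b} b∈ with a , a∈ , refl ← ∈ₗ.∈-map⁻ g b∈ =
      ∈ₗ.∈-filter⁺ (holds? q) (complete-ys b)
        (from image (a , proj₂ (∈ₗ.∈-filter⁻ (holds? p) {xs = xs} a∈) , refl))
    ⊆image : ∀ {b} → b ∈ₗ filter (holds? q) ys → b ∈ₗ map g (filter (holds? p) xs)
    ⊆image b∈ with a , pa , refl ← to image (proj₂ (∈ₗ.∈-filter⁻ (holds? q) {xs = ys} b∈)) =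
      ∈ₗ.∈-map⁺ g (∈ₗ.∈-filter⁺ (holds? p) (complete-xs a) pa)

module _ {A : Set} where

  countL-cong : ∀ {p q : A → Bool} → (∀ x → p x ≡ q x) → ∀ xs → countL p xs ≡ countL q xs
  countL-cong p≗q xs = cong length (Listₚ.filter-≐ (holds? _) (holds? _)
    ((λ {x} px → trans (sym (p≗q x)) px) , (λ {x} qx → trans (p≗q x) qx)) xs)

  countL-∷ : ∀ (p : A → Bool) x xs → countL p (x ∷ xs) ≡ (if p x then 1 else 0) + countL p xs
  countL-∷ p x xs with p x
  ... | true  = refl
  ... | false = refl

  countL-tabulate : ∀ {k} (p : A → Bool) (h : Fin k → A) →
    countL p (List.tabulate h) ≡ ∣ Vec.tabulate (p ∘ h) ∣
  countL-tabulate {zero}  p h = refl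
  countL-tabulate {suc k} p h with p (h zero)
  ... | true  = cong suc (countL-tabulate p (h ∘ suc))
  ... | false = countL-tabulate p (h ∘ suc)

  toList-tabulate : ∀ {k} (h : Fin k → A) → Vec.toList (Vec.tabulate h) ≡ List.tabulate h
  toList-tabulate {zero}  h = refl
  toList-tabulate {suc k} h = cong (h zero ∷_) (toList-tabulate (h ∘ suc))

countL-toList : ∀ {A : Set} {k} (p : A → Bool) (v : Vec A k) →
  countL p (Vec.toList v) ≡ countL (p ∘ Vec.lookup v) (allFin k)
countL-toList p v = begin
  countL p (Vec.toList v)                             ≡⟨ cong (countL p ∘ Vec.toList) (Vecₚ.tabulate∘lookup v) ⟨
  countL p (Vec.toList (Vec.tabulate (Vec.lookup v))) ≡⟨ cong (countL p) (toList-tabulate (Vec.lookup v)) ⟩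
  countL p (List.tabulate (Vec.lookup v))             ≡⟨ countL-tabulate p (Vec.lookup v) ⟩
  ∣ Vec.tabulate (p ∘ Vec.lookup v) ∣                 ≡⟨ countL-tabulate (p ∘ Vec.lookup v) (λ c → c) ⟨
  countL (p ∘ Vec.lookup v) (allFin _)                ∎
  where open ≡-Reasoning

∈ᵇ≡lookup : ∀ {n} (i : Fin n) (S : Subset n) → i ∈ᵇ S ≡ Vec.lookup S i
∈ᵇ≡lookup zero    (true  ∷ S) = refl
∈ᵇ≡lookup zero    (false ∷ S) = refl
∈ᵇ≡lookup (suc i) (_ ∷ S)     = trans (⌊⌋-map′ _ _ (i Subset.∈? S)) (∈ᵇ≡lookup i S)

∣∣≡countL-∈ᵇ : ∀ {n} (S : Subset n) → ∣ S ∣ ≡ countL (_∈ᵇ S) (allFin n)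
∣∣≡countL-∈ᵇ {n} S = begin
  ∣ S ∣                                ≡⟨ cong ∣_∣ (Vecₚ.tabulate∘lookup S) ⟨
  ∣ Vec.tabulate (Vec.lookup S) ∣      ≡⟨ countL-tabulate (Vec.lookup S) (λ i → i) ⟨
  countL (Vec.lookup S) (allFin n)     ≡⟨ countL-cong (λ i → sym (∈ᵇ≡lookup i S)) (allFin n) ⟩
  countL (_∈ᵇ S) (allFin n)            ∎
  where open ≡-Reasoning

module _ {A : Set} where

  sum-map-const0 : ∀ (xs : List A) → sum (map (λ _ → 0) xs) ≡ 0
  sum-map-const0 []       = refl
  sum-map-const0 (_ ∷ xs) = sum-map-const0 xs

  sum-map-const1 : ∀ (xs : List A) → sum (map (λ _ → 1) xs) ≡ length xs
  sum-map-const1 []       = refl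
  sum-map-const1 (_ ∷ xs) = cong suc (sum-map-const1 xs)

  sum-map-+ : ∀ (f g : A → ℕ) xs → sum (map (λ x → f x + g x) xs) ≡ sum (map f xs) + sum (map g xs)
  sum-map-+ f g []       = refl
  sum-map-+ f g (x ∷ xs) = trans (cong (f x + g x +_) (sum-map-+ f g xs))
                                 (interchange (f x) (g x) (sum (map f xs)) (sum (map g xs)))

  countL≡sum : ∀ (p : A → Bool) xs → countL p xs ≡ sum (map (λ x → if p x then 1 else 0) xs)
  countL≡sum p []       = refl
  countL≡sum p (x ∷ xs) = trans (countL-∷ p x xs) (cong (_ +_) (countL≡sum p xs))

sum-countL-comm : ∀ {A B : Set} (R : A → B → Bool) xs ys →
  sum (map (λ x → countL (R x) ys) xs) ≡ sum (map (λ y → countL (λ x → R x y) xs) ys)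
sum-countL-comm R []       ys = sym (sum-map-const0 ys)
sum-countL-comm R (x ∷ xs) ys = begin
  countL (R x) ys + sum (map (λ x → countL (R x) ys) xs)
    ≡⟨ cong₂ _+_ (countL≡sum (R x) ys) (sum-countL-comm R xs ys) ⟩
  sum (map (λ y → if R x y then 1 else 0) ys) + sum (map (λ y → countL (λ x → R x y) xs) ys)
    ≡⟨ sum-map-+ (λ y → if R x y then 1 else 0) (λ y → countL (λ x → R x y) xs) ys ⟨
  sum (map (λ y → (if R x y then 1 else 0) + countL (λ x → R x y) xs) ys)
    ≡⟨ cong sum (Listₚ.map-cong (λ y → sym (countL-∷ (λ x → R x y) x xs)) ys) ⟩
  sum (map (λ y → countL (λ x → R x y) (x ∷ xs)) ys) ∎
  where open ≡-Reasoning

sum-sizes-partition : ∀ {n} (Js : List (Subset n)) → (∀ i → countL (i ∈ᵇ_) Js ≡ 1) →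
  sum (map ∣_∣ Js) ≡ n
sum-sizes-partition {n} Js once = begin
  sum (map ∣_∣ Js)                                     ≡⟨ cong sum (Listₚ.map-cong ∣∣≡countL-∈ᵇ Js) ⟩
  sum (map (λ J → countL (_∈ᵇ J) (allFin n)) Js)       ≡⟨ sum-countL-comm (λ J i → i ∈ᵇ J) Js (allFin n) ⟩
  sum (map (λ i → countL (i ∈ᵇ_) Js) (allFin n))       ≡⟨ cong sum (Listₚ.map-cong once (allFin n)) ⟩
  sum (map (λ _ → 1) (allFin n))                       ≡⟨ sum-map-const1 (allFin n) ⟩
  length (allFin n)                                    ≡⟨ Listₚ.length-tabulate (λ i → i) ⟩
  n                                                    ∎
  where open ≡-Reasoning

-- Discreteness and generating collections

-- For a building set B, Independent B J says that B|_J is discrete; for a hypergraph H, that J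
-- contains no edge of H with at least two elements.
Independent : ∀ {n} → Coll n → Subset n → Set
Independent H J = ∀ S → S ∈ᶜ H → 2 ≤ ∣ S ∣ → ¬ S ⊆ J

discreteOn⇔Independent : ∀ {n} (B : Coll n) J → discreteOn B J ≡ true ⇔ Independent B J
discreteOn⇔Independent B J = mk⇔
  (λ discrete S S∈B 2≤∣S∣ S⊆J →
    to not≡true⇔ (to (all-complete⇔ ∈-allSubsets) discrete S)
      (from ∧≡true⇔ (S∈B , from ∧≡true⇔ (from (⌊⌋≡true⇔ {S ⊆ J} (S ⊆? J)) (λ {i} → S⊆J {i}) ,
                                          from ≤ᵇ≡true⇔ 2≤∣S∣))))
  (λ independent → from (all-complete⇔ ∈-allSubsets) λ S → from not≡true⇔ λ e →
    let S∈B , rest = to ∧≡true⇔ e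
        S⊆J , 2≤∣S∣ = to ∧≡true⇔ rest
    in independent S S∈B (to ≤ᵇ≡true⇔ 2≤∣S∣) (to (⌊⌋≡true⇔ {S ⊆ J} (S ⊆? J)) S⊆J))
  where open Subset using (_⊆?_)

0<∣∣⇒Nonempty : ∀ {n} {S : Subset n} → 0 < ∣ S ∣ → Nonempty S
0<∣∣⇒Nonempty {n} {S} 0<∣S∣ with Subset.nonempty? S
... | yes nonempty = nonempty
... | no empty     = contradiction (trans (cong ∣_∣ (Subset.Empty-unique empty)) (Subset.∣⊥∣≡0 n)) (ℕ.>⇒≢ 0<∣S∣)

⊆⇒≡⊎⊂ : ∀ {n} (p q : Subset n) → p ⊆ q → p ≡ q ⊎ p ⊂ q
⊆⇒≡⊎⊂ []            []            _   = inj₁ refl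
⊆⇒≡⊎⊂ (true ∷ p)    (false ∷ q)   p⊆q with () ← p⊆q Vec.here
⊆⇒≡⊎⊂ (false ∷ p)   (true ∷ q)    p⊆q = inj₂ (Subset.out⊂in (Subset.drop-∷-⊆ p⊆q))
⊆⇒≡⊎⊂ (true ∷ p)    (true ∷ q)    p⊆q =
  Sum.map (cong (true ∷_)) Subset.s⊂s (⊆⇒≡⊎⊂ p q (Subset.drop-∷-⊆ p⊆q))
⊆⇒≡⊎⊂ (false ∷ p)   (false ∷ q)   p⊆q =
  Sum.map (cong (false ∷_)) Subset.s⊂s (⊆⇒≡⊎⊂ p q (Subset.drop-∷-⊆ p⊆q))

⊇minimalElem : ∀ {n} (C : Coll n) {S} → S ∈ᶜ C → ∃ λ M → M ∈ᶜ minimalElems C × M ⊆ S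
⊇minimalElem {n} C {S} = descend (⊂-wellFounded S)
  where
  descend : ∀ {S} → Acc _⊂_ S → S ∈ᶜ C → ∃ λ M → M ∈ᶜ minimalElems C × M ⊆ S
  descend {S} (acc smaller) S∈C
    with any (λ T → C T ∧ (T ⊆ᵇ S) ∧ not (T ==ˢ S)) (allSubsets n) in below
  ... | false = S , from ∧≡true⇔ (S∈C , cong not below) , (λ i∈S → i∈S)
  ... | true with T , e ← to (any-complete⇔ ∈-allSubsets) below
    with T∈C , e ← to ∧≡true⇔ e
    with T⊆ᵇS , T≠ᵇS ← to ∧≡true⇔ e
    with ⊆⇒≡⊎⊂ T S (to (⌊⌋≡true⇔ (T Subset.⊆? S)) T⊆ᵇS)
  ... | inj₁ T≡S = contradiction (from (⌊⌋≡true⇔ (Vecₚ.≡-dec _≟ᵇ_ T S)) T≡S) (to not≡true⇔ T≠ᵇS)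
  ... | inj₂ T⊂S with M , M∈min , M⊆T ← descend (smaller T⊂S) T∈C = M , M∈min , Subset.p⊂q⇒p⊆q T⊂S ∘ M⊆T

module _ {n : ℕ} (C : Coll n) where

  private
    _≟ˢ_ : (S T : Subset n) → Dec (S ≡ T)
    _≟ˢ_ = Vecₚ.≡-dec _≟ᵇ_

  isSingleton? : ∀ S → Dec (∃ λ i → S ≡ ⁅ i ⁆)
  isSingleton? S = Finₚ.any? (λ i → S ≟ˢ ⁅ i ⁆)

  hasMemberBelow? : ∀ S → Dec (∃ λ T → T ∈ᶜ C × T ⊆ S)
  hasMemberBelow? S = Subset.anySubset? (λ T → holds? C T ×-dec (T Subset.⊆? S))

  singletonsOrAbove : Coll n
  singletonsOrAbove S = ⌊ isSingleton? S ⌋ ∨ ⌊ hasMemberBelow? S ⌋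

  ∈-singletonsOrAbove⇔ : ∀ {S} →
    S ∈ᶜ singletonsOrAbove ⇔ ((∃ λ i → S ≡ ⁅ i ⁆) ⊎ (∃ λ T → T ∈ᶜ C × T ⊆ S))
  ∈-singletonsOrAbove⇔ {S} = mk⇔
    (Sum.map (to (⌊⌋≡true⇔ (isSingleton? S))) (to (⌊⌋≡true⇔ (hasMemberBelow? S))) ∘ to ∨≡true⇔)
    (from ∨≡true⇔ ∘ Sum.map (from (⌊⌋≡true⇔ (isSingleton? S))) (from (⌊⌋≡true⇔ (hasMemberBelow? S))))

  singletonsOrAbove-isBuildingSet : (∀ T → T ∈ᶜ C → Nonempty T) → IsBuildingSet singletonsOrAbove
  singletonsOrAbove-isBuildingSet C-nonempty = record
    { nonempty = λ S S∈ → nonempty (to ∈-singletonsOrAbove⇔ S∈)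
    ; B1       = λ S S′ S∈ S′∈ ∩-nonempty →
                   from ∈-singletonsOrAbove⇔
                     (union (to ∈-singletonsOrAbove⇔ S∈) (to ∈-singletonsOrAbove⇔ S′∈) ∩-nonempty)
    ; B2       = λ i → from ∈-singletonsOrAbove⇔ (inj₁ (i , refl))
    }
    where
    nonempty : ∀ {S} → (∃ λ i → S ≡ ⁅ i ⁆) ⊎ (∃ λ T → T ∈ᶜ C × T ⊆ S) → Nonempty S
    nonempty (inj₁ (i , refl))          = i , Subset.x∈⁅x⁆ i
    nonempty (inj₂ (T , T∈C , T⊆S)) with i , i∈T ← C-nonempty T T∈C = i , T⊆S i∈T
    union : ∀ {S S′} → (∃ λ i → S ≡ ⁅ i ⁆) ⊎ (∃ λ T → T ∈ᶜ C × T ⊆ S) →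
      (∃ λ i → S′ ≡ ⁅ i ⁆) ⊎ (∃ λ T → T ∈ᶜ C × T ⊆ S′) → Nonempty (S ∩ S′) →
      (∃ λ i → S ∪ S′ ≡ ⁅ i ⁆) ⊎ (∃ λ T → T ∈ᶜ C × T ⊆ S ∪ S′)
    union (inj₂ (T , T∈C , T⊆S)) _ _ = inj₂ (T , T∈C , Subset.p⊆p∪q _ ∘ T⊆S)
    union (inj₁ _) (inj₂ (T , T∈C , T⊆S′)) _ = inj₂ (T , T∈C , Subset.q⊆p∪q _ _ ∘ T⊆S′)
    union {S} {S′} (inj₁ (i , refl)) (inj₁ (j , refl)) (x , x∈⁅i⁆∩⁅j⁆)
      with x∈⁅i⁆ , x∈⁅j⁆ ← Subset.x∈p∩q⁻ S S′ x∈⁅i⁆∩⁅j⁆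
      with refl ← Subset.x∈⁅y⁆⇒x≡y i x∈⁅i⁆
      with refl ← Subset.x∈⁅y⁆⇒x≡y j x∈⁅j⁆ = inj₁ (x , Subset.∪-idem ⁅ x ⁆)

module _ {n : ℕ} {B C : Coll n} (gen : IsGeneratingCollection B C) where

  open IsGeneratingCollection gen

  generators⊆ : C ⊆ᶜ B
  generators⊆ S S∈C = from (generates S) λ _ _ C⊆B′ → C⊆B′ S S∈C

  generators-nonempty : ∀ T → T ∈ᶜ C → Nonempty T
  generators-nonempty T T∈C = 0<∣∣⇒Nonempty (ℕ.<-≤-trans (s≤s z≤n) (atLeastTwo T T∈C))

  ⊇generator : ∀ {S} → S ∈ᶜ B → 2 ≤ ∣ S ∣ → ∃ λ T → T ∈ᶜ C × T ⊆ S
  ⊇generator {S} S∈B 2≤∣S∣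
    with to (∈-singletonsOrAbove⇔ C)
           (to (generates S) S∈B (singletonsOrAbove C) (singletonsOrAbove-isBuildingSet C generators-nonempty)
              (λ T T∈C → from (∈-singletonsOrAbove⇔ C) (inj₂ (T , T∈C , λ i∈T → i∈T))))
  ... | inj₁ (i , refl) = contradiction (Subset.∣⁅x⁆∣≡1 i) (ℕ.>⇒≢ 2≤∣S∣)
  ... | inj₂ below      = below

  Independent⇔Independent-minimalElems : ∀ J → Independent B J ⇔ Independent (minimalElems C) J
  Independent⇔Independent-minimalElems J = mk⇔
    (λ independent M M∈min → independent M (generators⊆ M (minimal⊆ M∈min)))
    (λ independent S S∈B 2≤∣S∣ S⊆J →
      let T , T∈C , T⊆S = ⊇generator S∈B 2≤∣S∣
          M , M∈min , M⊆T = ⊇minimalElem C T∈C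
      in independent M M∈min (atLeastTwo M (minimal⊆ M∈min)) (S⊆J ∘ T⊆S ∘ M⊆T))
    where
    minimal⊆ : ∀ {M} → M ∈ᶜ minimalElems C → M ∈ᶜ C
    minimal⊆ = proj₁ ∘ to ∧≡true⇔

-- Decompositions into discrete blocks

record IsGoodDecomposition {n} (B : Coll n) (α : List ℕ) (Js : Vec (Subset n) (length α)) : Set where
  field
    coversOnce : ∀ i → countL (i ∈ᵇ_) (Vec.toList Js) ≡ 1
    sizes      : map ∣_∣ (Vec.toList Js) ≡ α
    discrete   : All (Independent B) (Vec.toList Js)

sizes⇔ : ∀ {n} α (Js : Vec (Subset n) (length α)) →
  all (λ p → ∣ proj₁ p ∣ ≡ᵇ proj₂ p) (Vec.toList (Vec.zip Js (Vec.fromList α))) ≡ true ⇔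
  map ∣_∣ (Vec.toList Js) ≡ α
sizes⇔ []      []       = mk⇔ (λ _ → refl) (λ _ → refl)
sizes⇔ (a ∷ α) (J ∷ Js) = mk⇔
  (λ e → let J-size , Js-sizes = to ∧≡true⇔ e
         in cong₂ _∷_ (to ≡ᵇ≡true⇔ J-size) (to (sizes⇔ α Js) Js-sizes))
  (λ e → let J-size , Js-sizes = Listₚ.∷-injective e
         in from ∧≡true⇔ (from ≡ᵇ≡true⇔ J-size , from (sizes⇔ α Js) Js-sizes))

goodDecomp⇔ : ∀ {n} (B : Coll n) α Js → goodDecomp B α Js ≡ true ⇔ IsGoodDecomposition B α Js
goodDecomp⇔ B α Js = mk⇔
  (λ e → let once , rest = to ∧≡true⇔ e
             sized , discrete = to ∧≡true⇔ rest
         in record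
           { coversOnce = λ i → to ≡ᵇ≡true⇔ (to (all-complete⇔ ∈ₗ.∈-allFin) once i)
           ; sizes      = to (sizes⇔ α Js) sized
           ; discrete   = All.map (to (discreteOn⇔Independent B _)) (to all≡true⇔ discrete)
           })
  (λ good → let open IsGoodDecomposition good in
    from ∧≡true⇔ (from (all-complete⇔ ∈ₗ.∈-allFin) (λ i → from ≡ᵇ≡true⇔ (coversOnce i)) ,
    from ∧≡true⇔ (from (sizes⇔ α Js) sizes ,
                  from all≡true⇔ (All.map (from (discreteOn⇔Independent B _)) discrete))))

∣∣≡0⇒≡∅ : ∀ {n} {S : Subset n} → ∣ S ∣ ≡ 0 → S ≡ ∅
∣∣≡0⇒≡∅ {S = []}        _     = refl
∣∣≡0⇒≡∅ {S = false ∷ S} ∣S∣≡0 = cong (false ∷_) (∣∣≡0⇒≡∅ ∣S∣≡0)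

module _ {n : ℕ} where

  dropZeros : ∀ β → Vec (Subset n) (length β) → Vec (Subset n) (length (nonzeros β))
  dropZeros []          []       = []
  dropZeros (zero  ∷ β) (_ ∷ Ks) = dropZeros β Ks
  dropZeros (suc _ ∷ β) (K ∷ Ks) = K ∷ dropZeros β Ks

  padZeros : ∀ β → Vec (Subset n) (length (nonzeros β)) → Vec (Subset n) (length β)
  padZeros []          []       = []
  padZeros (zero  ∷ β) Js       = ∅ ∷ padZeros β Js
  padZeros (suc _ ∷ β) (J ∷ Js) = J ∷ padZeros β Js

  dropZeros∘padZeros : ∀ β Js → dropZeros β (padZeros β Js) ≡ Js
  dropZeros∘padZeros []          []       = refl
  dropZeros∘padZeros (zero  ∷ β) Js       = dropZeros∘padZeros β Js
  dropZeros∘padZeros (suc _ ∷ β) (J ∷ Js) = cong (J ∷_) (dropZeros∘padZeros β Js)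

  padZeros∘dropZeros : ∀ β Ks → map ∣_∣ (Vec.toList Ks) ≡ β → padZeros β (dropZeros β Ks) ≡ Ks
  padZeros∘dropZeros []          []       _     = refl
  padZeros∘dropZeros (zero  ∷ β) (K ∷ Ks) sizes with Listₚ.∷-injective sizes
  ... | ∣K∣≡0 , sizes′ = cong₂ _∷_ (sym (∣∣≡0⇒≡∅ ∣K∣≡0)) (padZeros∘dropZeros β Ks sizes′)
  padZeros∘dropZeros (suc _ ∷ β) (K ∷ Ks) sizes =
    cong (K ∷_) (padZeros∘dropZeros β Ks (Listₚ.∷-injectiveʳ sizes))

  sizes-padZeros⇔ : ∀ β Js → map ∣_∣ (Vec.toList (padZeros β Js)) ≡ β ⇔ map ∣_∣ (Vec.toList Js) ≡ nonzeros β
  sizes-padZeros⇔ []          []       = mk⇔ (λ _ → refl) (λ _ → refl)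
  sizes-padZeros⇔ (zero  ∷ β) Js       = mk⇔
    (to (sizes-padZeros⇔ β Js) ∘ Listₚ.∷-injectiveʳ)
    (cong₂ _∷_ (Subset.∣⊥∣≡0 n) ∘ from (sizes-padZeros⇔ β Js))
  sizes-padZeros⇔ (suc a ∷ β) (J ∷ Js) = mk⇔
    (λ e → let ∣J∣≡ , rest = Listₚ.∷-injective e in cong₂ _∷_ ∣J∣≡ (to (sizes-padZeros⇔ β Js) rest))
    (λ e → let ∣J∣≡ , rest = Listₚ.∷-injective e in cong₂ _∷_ ∣J∣≡ (from (sizes-padZeros⇔ β Js) rest))

  countL-padZeros : ∀ (p : Subset n → Bool) → p ∅ ≡ false →
    ∀ β Js → countL p (Vec.toList (padZeros β Js)) ≡ countL p (Vec.toList Js)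
  countL-padZeros p p∅ []          []       = refl
  countL-padZeros p p∅ (zero  ∷ β) Js       with p ∅ | p∅
  ... | false | refl = countL-padZeros p p∅ β Js
  countL-padZeros p p∅ (suc _ ∷ β) (J ∷ Js) with p J
  ... | true  = cong suc (countL-padZeros p p∅ β Js)
  ... | false = countL-padZeros p p∅ β Js

  All-padZeros⇔ : ∀ {P : Subset n → Set} → P ∅ →
    ∀ β Js → All P (Vec.toList (padZeros β Js)) ⇔ All P (Vec.toList Js)
  All-padZeros⇔ P∅ []          []       = mk⇔ (λ _ → []) (λ _ → [])
  All-padZeros⇔ P∅ (zero  ∷ β) Js       = mk⇔
    (to (All-padZeros⇔ P∅ β Js) ∘ All.tail)
    ((P∅ ∷_) ∘ from (All-padZeros⇔ P∅ β Js))
  All-padZeros⇔ P∅ (suc _ ∷ β) (J ∷ Js) = mk⇔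
    (λ { (pJ ∷ pJs) → pJ ∷ to (All-padZeros⇔ P∅ β Js) pJs })
    (λ { (pJ ∷ pJs) → pJ ∷ from (All-padZeros⇔ P∅ β Js) pJs })

  Independent-∅ : ∀ (B : Coll n) → Independent B ∅
  Independent-∅ B S _ 2≤∣S∣ S⊆∅ =
    contradiction (ℕ.≤-trans 2≤∣S∣ (ℕ.≤-trans (Subset.p⊆q⇒∣p∣≤∣q∣ S⊆∅) (ℕ.≤-reflexive (Subset.∣⊥∣≡0 n))))
                  λ ()

  ∉ᵇ∅ : ∀ (i : Fin n) → i ∈ᵇ ∅ ≡ false
  ∉ᵇ∅ i = trans (∈ᵇ≡lookup i ∅) (Vecₚ.lookup-replicate i false)

  padZeros-good⇔ : ∀ (B : Coll n) β Js →
    IsGoodDecomposition B β (padZeros β Js) ⇔ IsGoodDecomposition B (nonzeros β) Js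
  padZeros-good⇔ B β Js = mk⇔
    (λ good → let open IsGoodDecomposition good in record
      { coversOnce = λ i → trans (sym (countL-padZeros (i ∈ᵇ_) (∉ᵇ∅ i) β Js)) (coversOnce i)
      ; sizes      = to (sizes-padZeros⇔ β Js) sizes
      ; discrete   = to (All-padZeros⇔ (Independent-∅ B) β Js) discrete
      })
    (λ good → let open IsGoodDecomposition good in record
      { coversOnce = λ i → trans (countL-padZeros (i ∈ᵇ_) (∉ᵇ∅ i) β Js) (coversOnce i)
      ; sizes      = from (sizes-padZeros⇔ β Js) sizes
      ; discrete   = from (All-padZeros⇔ (Independent-∅ B) β Js) discrete
      })

ζ-nonzeros : ∀ {n} (B : Coll n) β → ζ (nonzeros β) B ≡ ζ β B
ζ-nonzeros {n} B β =
  countL-bijection (allVec-unique (allSubsets-unique n) _) (allVec-unique (allSubsets-unique n) _)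
    (∈-allVec-complete ∈-allSubsets) (∈-allVec-complete ∈-allSubsets)
    (padZeros β) padZeros-injective image
  where
  padZeros-injective : ∀ {Js Js′} → padZeros β Js ≡ padZeros β Js′ → Js ≡ Js′
  padZeros-injective {Js} {Js′} e =
    trans (sym (dropZeros∘padZeros β Js)) (trans (cong (dropZeros β) e) (dropZeros∘padZeros β Js′))
  image : ∀ {Ks} → goodDecomp B β Ks ≡ true ⇔ ∃ λ Js → goodDecomp B (nonzeros β) Js ≡ true × padZeros β Js ≡ Ks
  image {Ks} = mk⇔
    (λ Ks-good →
      let good = to (goodDecomp⇔ B β Ks) Ks-good
          Ks≡ = padZeros∘dropZeros β Ks (IsGoodDecomposition.sizes good)
      in dropZeros β Ks
       , from (goodDecomp⇔ B _ _) (to (padZeros-good⇔ B β _) (subst (IsGoodDecomposition B β) (sym Ks≡) good))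
       , Ks≡)
    (λ { (Js , Js-good , refl) →
      from (goodDecomp⇔ B β _) (from (padZeros-good⇔ B β Js) (to (goodDecomp⇔ B _ Js) Js-good)) })

-- Colourings and their colour classes

∈⇔lookup≡true : ∀ {n} {i : Fin n} {S : Subset n} → i ∈ S ⇔ Vec.lookup S i ≡ true
∈⇔lookup≡true {i = i} {S} = mk⇔ Vecₚ.[]=⇒lookup (Vecₚ.lookup⇒[]= i S)

∈ᵇ≡true⇔ : ∀ {n} {i : Fin n} {S : Subset n} → i ∈ᵇ S ≡ true ⇔ i ∈ S
∈ᵇ≡true⇔ {i = i} {S} = ⌊⌋≡true⇔ (i Subset.∈? S)

coversOnce⇔ : ∀ {m n} (Js : Vec (Subset n) m) (i : Fin n) →
  countL (i ∈ᵇ_) (Vec.toList Js) ≡ 1 ⇔ ∃! _≡_ (λ c → i ∈ Vec.lookup Js c)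
coversOnce⇔ {m} Js i = mk⇔
  (λ once → let c , i∈Jc , unique = to (countL≡1⇔∃! (Unique.allFin⁺ m) ∈ₗ.∈-allFin)
                                        (trans (sym (countL-toList (i ∈ᵇ_) Js)) once)
            in c , to ∈ᵇ≡true⇔ i∈Jc , λ {d} i∈Jd → unique (from ∈ᵇ≡true⇔ i∈Jd))
  (λ (c , i∈Jc , unique) → trans (countL-toList (i ∈ᵇ_) Js)
      (from (countL≡1⇔∃! (Unique.allFin⁺ m) ∈ₗ.∈-allFin)
        (c , from ∈ᵇ≡true⇔ i∈Jc , λ {d} i∈Jd → unique (to ∈ᵇ≡true⇔ i∈Jd))))

module _ {m n : ℕ} where

  colourClass : Vec (Fin m) n → Fin m → Subset n
  colourClass f c = Vec.tabulate (λ i → ⌊ Vec.lookup f i Finₚ.≟ c ⌋)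

  colourClasses : Vec (Fin m) n → Vec (Subset n) m
  colourClasses f = Vec.tabulate (colourClass f)

  ∈-colourClass⇔ : ∀ {f c i} → i ∈ colourClass f c ⇔ Vec.lookup f i ≡ c
  ∈-colourClass⇔ {f} {c} {i} = mk⇔
    (λ i∈ → to (⌊⌋≡true⇔ _) (trans (sym (Vecₚ.lookup∘tabulate _ i)) (to ∈⇔lookup≡true i∈)))
    (λ fi≡c → from ∈⇔lookup≡true
       (trans (Vecₚ.lookup∘tabulate _ i) (from (⌊⌋≡true⇔ (Vec.lookup f i Finₚ.≟ c)) fi≡c)))

  ∈-colourClasses⇔ : ∀ {f c i} → i ∈ Vec.lookup (colourClasses f) c ⇔ Vec.lookup f i ≡ c
  ∈-colourClasses⇔ {f} {c} {i} rewrite Vecₚ.lookup∘tabulate (colourClass f) c = ∈-colourClass⇔ {f}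

  colourClasses-injective : ∀ {f g} → colourClasses f ≡ colourClasses g → f ≡ g
  colourClasses-injective {f} {g} classes≡ = begin
    f                       ≡⟨ Vecₚ.tabulate∘lookup f ⟨
    Vec.tabulate (Vec.lookup f) ≡⟨ Vecₚ.tabulate-cong same-colour ⟩
    Vec.tabulate (Vec.lookup g) ≡⟨ Vecₚ.tabulate∘lookup g ⟩
    g                       ∎
    where
    open ≡-Reasoning
    same-colour : ∀ i → Vec.lookup f i ≡ Vec.lookup g i
    same-colour i = sym (to (∈-colourClasses⇔ {g}) (subst (λ Ks → i ∈ Vec.lookup Ks (Vec.lookup f i)) classes≡
                                                     (from (∈-colourClasses⇔ {f}) refl)))

  colourClasses-coversOnce : ∀ f i → countL (i ∈ᵇ_) (Vec.toList (colourClasses f)) ≡ 1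
  colourClasses-coversOnce f i =
    from (coversOnce⇔ (colourClasses f) i)
      (Vec.lookup f i , from (∈-colourClasses⇔ {f}) refl , λ i∈ → to (∈-colourClasses⇔ {f}) i∈)

  colouringOf : (Js : Vec (Subset n) m) → (∀ i → ∃! _≡_ (λ c → i ∈ Vec.lookup Js c)) → Vec (Fin m) n
  colouringOf Js once = Vec.tabulate (proj₁ ∘ once)

  colourClasses-colouringOf : ∀ Js once → colourClasses (colouringOf Js once) ≡ Js
  colourClasses-colouringOf Js once = begin
    Vec.tabulate (colourClass f)     ≡⟨ Vecₚ.tabulate-cong (λ c → Subset.⊆-antisym (⊆Jc c) (Jc⊆ c)) ⟩
    Vec.tabulate (Vec.lookup Js)     ≡⟨ Vecₚ.tabulate∘lookup Js ⟩
    Js                               ∎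
    where
    open ≡-Reasoning
    f = colouringOf Js once
    colour : ∀ i → Vec.lookup f i ≡ proj₁ (once i)
    colour i = Vecₚ.lookup∘tabulate (proj₁ ∘ once) i
    ⊆Jc : ∀ c → colourClass f c ⊆ Vec.lookup Js c
    ⊆Jc c {i} i∈ with refl ← trans (sym (colour i)) (to (∈-colourClass⇔ {f}) i∈) = proj₁ (proj₂ (once i))
    Jc⊆ : ∀ c → Vec.lookup Js c ⊆ colourClass f c
    Jc⊆ c {i} i∈Jc = from (∈-colourClass⇔ {f}) (trans (colour i) (proj₂ (proj₂ (once i)) i∈Jc))

map-toList≡⇔ : ∀ {A : Set} (g : A → ℕ) α (v : Vec A (length α)) →
  map g (Vec.toList v) ≡ α ⇔ (∀ c → g (Vec.lookup v c) ≡ List.lookup α c)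
map-toList≡⇔ g []      []      = mk⇔ (λ _ ()) (λ _ → refl)
map-toList≡⇔ g (a ∷ α) (x ∷ v) = mk⇔
  (λ { e zero → Listₚ.∷-injectiveˡ e ; e (suc c) → to (map-toList≡⇔ g α v) (Listₚ.∷-injectiveʳ e) c })
  (λ h → cong₂ _∷_ (h zero) (from (map-toList≡⇔ g α v) (h ∘ suc)))

All-toList⇔ : ∀ {A : Set} {P : A → Set} {k} (v : Vec A k) → All P (Vec.toList v) ⇔ (∀ c → P (Vec.lookup v c))
All-toList⇔ v = mk⇔ (VecAllₚ.lookup⁺ ∘ VecAllₚ.toList⁻) (VecAllₚ.toList⁺ ∘ VecAllₚ.lookup⁻)

module _ {n : ℕ} (β : List ℕ) (f : Vec (Fin (length β)) n) where

  sizes-colourClasses⇔ : map ∣_∣ (Vec.toList (colourClasses f)) ≡ β ⇔ hasExponents β f ≡ true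
  sizes-colourClasses⇔ = mk⇔
    (λ sizes → from (all-complete⇔ ∈ₗ.∈-allFin) λ c →
      from ≡ᵇ≡true⇔ (trans (sym (∣colourClass∣ c)) (to (map-toList≡⇔ ∣_∣ β _) sizes c)))
    (λ exponents → from (map-toList≡⇔ ∣_∣ β _) λ c →
      trans (∣colourClass∣ c) (to ≡ᵇ≡true⇔ (to (all-complete⇔ ∈ₗ.∈-allFin) exponents c)))
    where
    ∣colourClass∣ : ∀ c →
      ∣ Vec.lookup (colourClasses f) c ∣ ≡ countL (λ i → ⌊ Vec.lookup f i Finₚ.≟ c ⌋) (allFin n)
    ∣colourClass∣ c = trans (cong ∣_∣ (Vecₚ.lookup∘tabulate (colourClass f) c))
                            (sym (countL-tabulate (λ i → ⌊ Vec.lookup f i Finₚ.≟ c ⌋) (λ i → i)))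

module _ {m n : ℕ} (f : Vec (Fin m) n) where

  Polychromatic : Subset n → Set
  Polychromatic S = ∃₂ λ i j → i ∈ S × j ∈ S × Vec.lookup f i ≢ Vec.lookup f j

  polychromaticᵇ : Subset n → Bool
  polychromaticᵇ S =
    any (λ i → any (λ j → (i ∈ᵇ S) ∧ (j ∈ᵇ S) ∧ not ⌊ Vec.lookup f i Finₚ.≟ Vec.lookup f j ⌋) (allFin n)) (allFin n)

  polychromatic⇔ : ∀ S → polychromaticᵇ S ≡ true ⇔ Polychromatic S
  polychromatic⇔ S = mk⇔
    (λ e → let i , e = to (any-complete⇔ ∈ₗ.∈-allFin) e
               j , e = to (any-complete⇔ ∈ₗ.∈-allFin) e
               i∈S , e = to ∧≡true⇔ e
               j∈S , fi≢fj = to ∧≡true⇔ e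
           in i , j , to ∈ᵇ≡true⇔ i∈S , to ∈ᵇ≡true⇔ j∈S , to not≡true⇔ fi≢fj ∘ from (⌊⌋≡true⇔ _))
    (λ (i , j , i∈S , j∈S , fi≢fj) →
      from (any-complete⇔ ∈ₗ.∈-allFin) (i , from (any-complete⇔ ∈ₗ.∈-allFin) (j ,
        from ∧≡true⇔ (from ∈ᵇ≡true⇔ i∈S , from ∧≡true⇔ (from ∈ᵇ≡true⇔ j∈S ,
          from not≡true⇔ (fi≢fj ∘ to (⌊⌋≡true⇔ (Vec.lookup f i Finₚ.≟ Vec.lookup f j))))))))

  Polychromatic⇒⊈colourClass : ∀ {S} c → Polychromatic S → ¬ S ⊆ colourClass f c
  Polychromatic⇒⊈colourClass c (i , j , i∈S , j∈S , fi≢fj) S⊆class =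
    fi≢fj (trans (to (∈-colourClass⇔ {f = f}) (S⊆class i∈S)) (sym (to (∈-colourClass⇔ {f = f}) (S⊆class j∈S))))

  ¬Polychromatic⇒⊆colourClass : ∀ {S i} → ¬ Polychromatic S → i ∈ S → S ⊆ colourClass f (Vec.lookup f i)
  ¬Polychromatic⇒⊆colourClass {S} {i} monochromatic i∈S {j} j∈S with Vec.lookup f j Finₚ.≟ Vec.lookup f i
  ... | yes fj≡fi = from (∈-colourClass⇔ {f = f}) fj≡fi
  ... | no  fj≢fi = contradiction (j , i , j∈S , i∈S , fj≢fi) monochromatic

  proper⇔ : ∀ (H : Coll n) → proper H f ≡ true ⇔ (∀ c → Independent H (colourClass f c))
  proper⇔ H = mk⇔
    (λ isProper c S S∈H 2≤∣S∣ S⊆class →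
      [ (λ notEdge → to not≡true⇔ notEdge (from ∧≡true⇔ (S∈H , from ≤ᵇ≡true⇔ 2≤∣S∣)))
      , (λ poly → Polychromatic⇒⊈colourClass c (to (polychromatic⇔ S) poly) (λ {j} → S⊆class {j}))
      ]′ (to ∨≡true⇔ (to (all-complete⇔ ∈-allSubsets) isProper S)))
    (λ independent → from (all-complete⇔ ∈-allSubsets) (properAt independent))
    where
    properAt : (∀ c → Independent H (colourClass f c)) → ∀ S →
      (not (H S ∧ (2 ≤ᵇ ∣ S ∣)) ∨ polychromaticᵇ S) ≡ true
    properAt independent S with H S ∧ (2 ≤ᵇ ∣ S ∣) in isEdge
    ... | false = refl
    ... | true with polychromaticᵇ S in poly
    ... | true  = refl
    ... | false =
      let S∈H , 2≤ᵇ∣S∣ = to ∧≡true⇔ isEdge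
          2≤∣S∣ = to ≤ᵇ≡true⇔ 2≤ᵇ∣S∣
          i , i∈S = 0<∣∣⇒Nonempty (ℕ.<-≤-trans (s≤s z≤n) 2≤∣S∣)
          monochromatic = λ polychromatic →
            contradiction (trans (sym poly) (from (polychromatic⇔ S) polychromatic)) λ ()
      in contradiction (λ {j} → ¬Polychromatic⇒⊆colourClass monochromatic i∈S {j})
                       (independent (Vec.lookup f i) S S∈H 2≤∣S∣)

module _ {n : ℕ} {B C : Coll n} (gen : IsGeneratingCollection B C) (β : List ℕ) where

  colourClasses-good⇔ : ∀ f →
    IsGoodDecomposition B β (colourClasses f) ⇔ (proper (minimalElems C) f ∧ hasExponents β f) ≡ true
  colourClasses-good⇔ f = mk⇔
    (λ good → let open IsGoodDecomposition good in
      from ∧≡true⇔ ( from (proper⇔ f (minimalElems C)) (λ c → to (class-independent⇔ c) (to (All-toList⇔ _) discrete c))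
                   , to (sizes-colourClasses⇔ β f) sizes))
    (λ e → let isProper , exponents = to ∧≡true⇔ e in record
      { coversOnce = colourClasses-coversOnce f
      ; sizes      = from (sizes-colourClasses⇔ β f) exponents
      ; discrete   = from (All-toList⇔ _) λ c → from (class-independent⇔ c) (to (proper⇔ f (minimalElems C)) isProper c)
      })
    where
    class-independent⇔ : ∀ c →
      Independent B (Vec.lookup (colourClasses f) c) ⇔ Independent (minimalElems C) (colourClass f c)
    class-independent⇔ c rewrite Vecₚ.lookup∘tabulate (colourClass f) c =
      Independent⇔Independent-minimalElems gen (colourClass f c)

  coeffΨHyper≡ζ : coeffΨHyper (minimalElems C) β ≡ ζ β B
  coeffΨHyper≡ζ =
    countL-bijection (allVec-unique (Unique.allFin⁺ _) n) (allVec-unique (allSubsets-unique n) _)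
      ∈-allColourings (∈-allVec-complete ∈-allSubsets) colourClasses colourClasses-injective image
    where
    image : ∀ {Ks} → goodDecomp B β Ks ≡ true ⇔
      ∃ λ f → (proper (minimalElems C) f ∧ hasExponents β f) ≡ true × colourClasses f ≡ Ks
    image {Ks} = mk⇔
      (λ Ks-good →
        let good = to (goodDecomp⇔ B β Ks) Ks-good
            once = λ i → to (coversOnce⇔ Ks i) (IsGoodDecomposition.coversOnce good i)
            Ks≡ = colourClasses-colouringOf Ks once
        in colouringOf Ks once
         , to (colourClasses-good⇔ (colouringOf Ks once)) (subst (IsGoodDecomposition B β) (sym Ks≡) good)
         , Ks≡)
      (λ { (f , f-proper , refl) → from (goodDecomp⇔ B β _) (from (colourClasses-good⇔ f) f-proper) })

-- Compositions and the coefficient of x^β in Ψ(B)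

nonzeros-positive : ∀ β → All (0 <_) (nonzeros β)
nonzeros-positive []          = []
nonzeros-positive (zero  ∷ β) = nonzeros-positive β
nonzeros-positive (suc _ ∷ β) = s≤s z≤n ∷ nonzeros-positive β

length≤sum : ∀ {α} → All (0 <_) α → length α ≤ sum α
length≤sum []                 = z≤n
length≤sum {a ∷ _} (0<a ∷ pos) = ℕ.+-mono-≤ 0<a (length≤sum pos)

∈⇒≤sum : ∀ {a α} → a ∈ₗ α → a ≤ sum α
∈⇒≤sum {α = b ∷ α} (here refl) = ℕ.m≤m+n b (sum α)
∈⇒≤sum {α = b ∷ α} (there a∈α) = ℕ.≤-trans (∈⇒≤sum a∈α) (ℕ.m≤n+m (sum α) b)

module _ (n : ℕ) where

  private
    parts : List ℕ
    parts = map suc (List.upTo n)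

    ofLength : ℕ → List (List ℕ)
    ofLength k = map Vec.toList (allVec parts k)

    candidates : List (List ℕ)
    candidates = concatMap ofLength (List.upTo (suc n))

  ∈-compositions⁻ : ∀ {α} → α ∈ₗ compositions n → sum α ≡ n
  ∈-compositions⁻ = proj₂ ∘ ∈ₗ.∈-filter⁻ (λ α → sum α ℕ.≟ n) {xs = candidates}

  ∈-compositions⁺ : ∀ {α} → All (0 <_) α → sum α ≡ n → α ∈ₗ compositions n
  ∈-compositions⁺ {α} pos sum≡n = ∈ₗ.∈-filter⁺ (λ α → sum α ℕ.≟ n) {xs = candidates}
    (∈ₗ.∈-concatMap⁺ ofLength
      (lose (∈ₗ.∈-upTo⁺ (s≤s (ℕ.≤-trans (length≤sum pos) (ℕ.≤-reflexive sum≡n)))) α∈ofLength))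
    sum≡n
    where
    part : ∀ {a} → a ∈ₗ α → a ∈ₗ parts
    part {suc a} a∈α = ∈ₗ.∈-map⁺ suc (∈ₗ.∈-upTo⁺ (ℕ.≤-trans (∈⇒≤sum a∈α) (ℕ.≤-reflexive sum≡n)))
    part {zero}  a∈α = contradiction (All.lookup pos a∈α) λ ()
    α∈ofLength : α ∈ₗ ofLength (length α)
    α∈ofLength = subst (_∈ₗ ofLength (length α)) (Vecₚ.toList∘fromList α)
      (∈ₗ.∈-map⁺ Vec.toList (∈-allVec (VecAllₚ.fromList⁺ (All.tabulate part))))

  compositions-unique : Unique (compositions n)
  compositions-unique = Unique.filter⁺ (λ α → sum α ℕ.≟ n) {candidates}
    (Unique.concat⁺ (All.tabulate ofLength-unique) (AllPairs.map⁺ (AllPairs.map lengths-differ (Unique.upTo⁺ (suc n)))))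
    where
    toList-injective : ∀ {k} {u v : Vec ℕ k} → Vec.toList u ≡ Vec.toList v → u ≡ v
    toList-injective {u = u} {v} e = trans (sym (Vecₚ.cast-is-id refl u)) (Vecₚ.toList-injective refl u v e)
    parts-unique : Unique parts
    parts-unique = Unique.map⁺ ℕ.suc-injective (Unique.upTo⁺ n)
    ofLength-unique : ∀ {αs} → αs ∈ₗ map ofLength (List.upTo (suc n)) → Unique αs
    ofLength-unique αs∈ with k , _ , refl ← ∈ₗ.∈-map⁻ ofLength {xs = List.upTo (suc n)} αs∈ =
      Unique.map⁺ toList-injective (allVec-unique parts-unique k)
    length-ofLength : ∀ {k α} → α ∈ₗ ofLength k → length α ≡ k
    length-ofLength {k} α∈ with v , _ , refl ← ∈ₗ.∈-map⁻ Vec.toList α∈ = Vecₚ.length-toList v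
    lengths-differ : ∀ {k l} → k ≢ l → Disjoint (ofLength k) (ofLength l)
    lengths-differ k≢l (α∈k , α∈l) = k≢l (trans (sym (length-ofLength α∈k)) (length-ofLength α∈l))

listEq≡true⇔ : ∀ {xs ys} → listEq xs ys ≡ true ⇔ xs ≡ ys
listEq≡true⇔ {[]}     {[]}     = mk⇔ (λ _ → refl) (λ _ → refl)
listEq≡true⇔ {[]}     {_ ∷ _}  = mk⇔ (λ ()) (λ ())
listEq≡true⇔ {_ ∷ _}  {[]}     = mk⇔ (λ ()) (λ ())
listEq≡true⇔ {x ∷ xs} {y ∷ ys} = mk⇔
  (λ e → let x≡y , xs≡ys = to ∧≡true⇔ e in cong₂ _∷_ (to ≡ᵇ≡true⇔ x≡y) (to listEq≡true⇔ xs≡ys))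
  (λ e → let x≡y , xs≡ys = Listₚ.∷-injective e
         in from ∧≡true⇔ (from ≡ᵇ≡true⇔ x≡y , from listEq≡true⇔ xs≡ys))

module _ (F : List ℕ → ℕ) (β : List ℕ) where

  private
    term : List ℕ → ℕ
    term α = F α * coeffM α β

    term-≢ : ∀ {α} → α ≢ nonzeros β → term α ≡ 0
    term-≢ {α} α≢ with listEq (nonzeros β) α in e
    ... | true  = contradiction (sym (to listEq≡true⇔ e)) α≢
    ... | false = ℕ.*-zeroʳ (F α)

    term-nonzeros : term (nonzeros β) ≡ F (nonzeros β)
    term-nonzeros rewrite from (listEq≡true⇔ {nonzeros β}) refl = ℕ.*-identityʳ _

  sum-coeffM-∉ : ∀ {αs} → ¬ nonzeros β ∈ₗ αs → sum (map term αs) ≡ 0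
  sum-coeffM-∉ {[]}     _ = refl
  sum-coeffM-∉ {α ∷ αs} ∉ =
    cong₂ _+_ (term-≢ (λ { refl → ∉ (here refl) })) (sum-coeffM-∉ (∉ ∘ there))

  sum-coeffM-∈ : ∀ {αs} → Unique αs → nonzeros β ∈ₗ αs → sum (map term αs) ≡ F (nonzeros β)
  sum-coeffM-∈ (α∉αs ∷ _) (here refl) =
    trans (cong₂ _+_ term-nonzeros (sum-coeffM-∉ λ ∈αs → All.lookup α∉αs ∈αs refl)) (ℕ.+-identityʳ _)
  sum-coeffM-∈ {α ∷ _} (α∉αs ∷ unique) (there ∈αs) =
    cong₂ _+_ (term-≢ λ { refl → All.lookup α∉αs ∈αs refl }) (sum-coeffM-∈ unique ∈αs)

countL-none : ∀ {A : Set} (p : A → Bool) xs → (∀ x → ¬ p x ≡ true) → countL p xs ≡ 0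
countL-none p xs none = cong length (Listₚ.filter-none (holds? p) {xs} (All.tabulate λ {x} _ → none x))

ζ-≢ : ∀ {n} (B : Coll n) α → sum α ≢ n → ζ α B ≡ 0
ζ-≢ {n} B α sum≢n = countL-none (goodDecomp B α) (allVec (allSubsets n) (length α)) λ Js good →
  let open IsGoodDecomposition (to (goodDecomp⇔ B α Js) good)
  in sum≢n (trans (cong sum (sym sizes)) (sum-sizes-partition (Vec.toList Js) coversOnce))

coeffΨBuilding≡ζ : ∀ {n} (B : Coll n) β → coeffΨBuilding B β ≡ ζ (nonzeros β) B
coeffΨBuilding≡ζ {n} B β with sum (nonzeros β) ℕ.≟ n
... | yes sum≡n =
  sum-coeffM-∈ (λ α → ζ α B) β (compositions-unique n) (∈-compositions⁺ n (nonzeros-positive β) sum≡n)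
... | no  sum≢n =
  trans (sum-coeffM-∉ (λ α → ζ α B) β (sum≢n ∘ ∈-compositions⁻ n)) (sym (ζ-≢ B (nonzeros β) sum≢n))

theorem2 : ∀ (n : ℕ) (B C : Coll n) → IsBuildingSet B → IsGeneratingCollection B C →
    ∀ (β : List ℕ) → coeffΨBuilding B β ≡ coeffΨHyper (minimalElems C) β
theorem2 n B C _ gen β = begin
  coeffΨBuilding B β              ≡⟨ coeffΨBuilding≡ζ B β ⟩
  ζ (nonzeros β) B                ≡⟨ ζ-nonzeros B β ⟩
  ζ β B                           ≡⟨ coeffΨHyper≡ζ gen β ⟨
  coeffΨHyper (minimalElems C) β  ∎
  where open ≡-Reasoning
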